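{- Let $A$ be a single-agent online exploration algorithm for unicyclic graphs which, for every unicyclic graph $G$ and start node $s$, explores $G$ with cost at most $3\cdot opt(G,s,1)$. Then for every $n$ and every $n$-tadpole graph $G$ with start node $s$, exploring $G$ with a single agent running $A$ has cost at most $12\cdot opt(G,s,2)$, where $opt(G,s,2)$ is the optimal offline cost using two agents. This holds in the time model as well as in the energy model.
   Context: Online graph exploration: an undirected connected graph $G=(V,E)$ with positive edge lengths $l(e)$ and distinctly labelled nodes is initially unknown. Agents start at a node $s$; initially they know $s$, its incident edges (with lengths) and its neighbours. Whenever an agent visits a node $v$ for the first time, all edges incident to $v$ (with lengths) and the neighbours of $v$ are revealed. Agents share all information instantly, move at unit speed (traversing $e$ takes time $l(e)$), and may wait. The exploration is finished when every node has been visited and all agents are back at $s$. Time model: cost is the finishing time. Energy model: cost is the maximum total distance travelled by any single agent. $opt(G,s,k)$ is the minimum cost of an exploration by $k$ agents with full prior knowledge of $G$. A unicyclic graph is a connected graph containing exactly one cycle. An $n$-tadpole graph consists of a cycle to which $n$ tails (paths, each with at least one edge, attached at one endpoint to a cycle node) are attached; several tails may be attached to the same cycle node. Every $n$-tadpole graph is unicyclic.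
   Formalization: The edge lengths $l(e)$ are positive rationals, and the waiting times the agent may choose are rational as well. -}

module Defs where

open import Data.Nat as ℕ using (ℕ; zero; suc)
open import Data.Integer using (+_)
open import Data.Rational using (ℚ; 0ℚ; _+_; _<_; _≤_; _⊔_; _/_)
open import Data.Rational.Properties using (_<?_)
open import Data.Fin using (Fin)
open import Data.List using (List; []; _∷_; _++_; length; head; last; concat; mapMaybe; allFin)
open import Data.List.Membership.Propositional using (_∈_)
open import Data.List.Relation.Unary.Linked using (Linked)
open import Data.List.Relation.Unary.Unique.Propositional using (Unique)
open import Data.Vec using (Vec; lookup; toList; foldr′)
open import Data.Maybe using (Maybe; just; nothing; fromMaybe; _>>=_)
open import Data.Product using (Σ; ∃; _×_; _,_)
open import Data.Sum using (_⊎_)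
open import Relation.Binary.PropositionalEquality using (_≡_)
open import Relation.Nullary using (yes; no)
open import Function.Definitions using (Injective)

record Graph : Set where
  field
    N      : ℕ
    w      : Fin N → Fin N → Maybe ℚ     -- w u v = just l  iff  {u,v} ∈ E with length l
    w-sym  : ∀ u v → w u v ≡ w v u
    w-irr  : ∀ v → w v v ≡ nothing
    w-pos  : ∀ u v l → w u v ≡ just l → 0ℚ < l
    lab    : Fin N → ℕ
    lab-inj : Injective _≡_ _≡_ lab

module _ (G : Graph) where
  open Graph G

  V : Set
  V = Fin N

  Adj : V → V → Set
  Adj u v = ∃ λ l → w u v ≡ just l

  -- length of the edge (0 if there is no edge; only used on walks)
  wt : V → V → ℚ
  wt u v = fromMaybe 0ℚ (w u v)

  walkLen : List V → ℚ
  walkLen []           = 0ℚ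
  walkLen (x ∷ [])     = 0ℚ
  walkLen (x ∷ y ∷ r)  = wt x y + walkLen (y ∷ r)

  IsWalk : List V → Set
  IsWalk = Linked Adj

  Connected : Set
  Connected = ∀ u v → ∃ λ p → IsWalk p × head p ≡ just u × last p ≡ just v

data Consec {A : Set} : List A → A → A → Set where
  here  : ∀ {x y r} → Consec (x ∷ y ∷ r) x y
  there : ∀ {x r u v} → Consec r u v → Consec (x ∷ r) u v

PathEdge : {A : Set} → List A → A → A → Set
PathEdge p u v = Consec p u v ⊎ Consec p v u

close : {A : Set} → List A → List A
close []      = []
close (x ∷ r) = x ∷ (r ++ x ∷ [])

CycEdge : {A : Set} → List A → A → A → Set
CycEdge c = PathEdge (close c)

module _ (G : Graph) where
  open Graph G

  IsCycle : List (V G) → Set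
  IsCycle c = 3 ℕ.≤ length c × Unique c × Linked (Adj G) (close c)

  SameCycle : List (V G) → List (V G) → Set
  SameCycle c c′ = ∀ u v → (CycEdge c u v → CycEdge c′ u v) × (CycEdge c′ u v → CycEdge c u v)

  Unicyclic : Set
  Unicyclic = Connected G × Σ (List (V G)) λ c → IsCycle c × (∀ c′ → IsCycle c′ → SameCycle c c′)

  -- n-tadpole: a cycle c plus n tails; tail i is the path  att_i , t_i1 , … , t_ik
  -- (k ≥ 1 edges) attached at cycle node att_i; every node lies on exactly one of
  -- the cycle / the tails (apart from attachment nodes), and the edges are exactly
  -- the cycle edges and the tail edges.
  IsTadpole : ℕ → Set
  IsTadpole n =
    Σ (List (V G)) λ c → IsCycle c ×
    Σ (Vec (List (V G)) n) λ tails →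
    Σ (Vec (V G) n) λ att →
      (∀ i → lookup att i ∈ c) ×
      (∀ i → 1 ℕ.≤ length (lookup tails i)) ×
      Unique (c ++ concat (toList tails)) ×
      (∀ v → v ∈ (c ++ concat (toList tails))) ×
      (∀ u v → (Adj G u v → CycEdge c u v ⊎ ∃ λ i → PathEdge (lookup att i ∷ lookup tails i) u v)
             × (CycEdge c u v ⊎ (∃ λ i → PathEdge (lookup att i ∷ lookup tails i) u v) → Adj G u v))

data Model : Set where
  time energy : Model

-- Cost (time and energy model alike): the largest walk length.

module _ (G : Graph) (s : V G) where

  OfflineExpl : (k : ℕ) → Vec (List (V G)) k → Set
  OfflineExpl k ws =
    (∀ i → IsWalk G (lookup ws i) × head (lookup ws i) ≡ just s × last (lookup ws i) ≡ just s) ×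
    (∀ v → ∃ λ i → v ∈ lookup ws i)

offCost : (G : Graph) → Model → ∀ {k} → Vec (List (V G)) k → ℚ
offCost G _ ws = foldr′ (λ p acc → walkLen G p ⊔ acc) 0ℚ ws

-- what is revealed on visiting a node: its label and its incident edges
-- (label of the neighbour, length)
Obs : Set
Obs = ℕ × List (ℕ × ℚ)

data Event : Set where
  arrive : Obs → Event
  waited : ℚ → Event

data Action : Set where
  move : ℕ → Action        -- traverse the edge to the neighbour with this label
  wait : ℚ → Action
  stop : Action

-- an online algorithm decides from the history of observations only
-- (most recent event first)
Algorithm : Set
Algorithm = List Event → Action

module _ (G : Graph) (s : V G) (A : Algorithm) where
  open Graph G

  obs : V G → Obs
  obs v = lab v , mapMaybe (λ u → Data.Maybe.map (λ l → lab u , l) (w v u)) (allFin N)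

  findNbr : ℕ → V G → Maybe (V G × ℚ)
  findNbr ℓ v = go (allFin N)
    where
      go : List (V G) → Maybe (V G × ℚ)
      go [] = nothing
      go (u ∷ us) with w v u | ℓ ℕ.≟ lab u
      ... | just l  | yes _ = just (u , l)
      ... | _       | _     = go us

  record Config : Set where
    constructor cfg
    field
      pos     : V G
      hist    : List Event
      visited : List (V G)
      elapsed : ℚ      -- total time so far (moving + waiting)
      dist    : ℚ

  open Config

  initial : Config
  initial = cfg s (arrive (obs s) ∷ []) (s ∷ []) 0ℚ 0ℚ

  step : Config → Maybe Config
  step c with A (hist c)
  ... | move ℓ with findNbr ℓ (pos c)
  ...   | just (u , l) = just (cfg u (arrive (obs u) ∷ hist c) (u ∷ visited c) (elapsed c + l) (dist c + l))
  ...   | nothing      = nothing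
  step c | wait q with 0ℚ <? q
  ...   | yes _ = just (cfg (pos c) (waited q ∷ hist c) (visited c) (elapsed c + q) (dist c))
  ...   | no _  = nothing
  step c | stop = nothing

  run : ℕ → Maybe Config
  run zero    = just initial
  run (suc k) = run k >>= step

  Finished : Config → Set
  Finished c = pos c ≡ s × (∀ v → v ∈ visited c)

  costOf : Model → Config → ℚ
  costOf time   c = elapsed c
  costOf energy c = dist c

  -- the run reaches a configuration where exploration is finished, with cost ≤ B
  -- (costs are monotone along the run, so this says: the finishing cost is ≤ B)
  ExploresWithin : Model → ℚ → Set
  ExploresWithin m B = ∃ λ k → ∃ λ c → run k ≡ just c × Finished c × costOf m c ≤ B

three twelve : ℚ
three  = + 3 / 1
twelve = + 12 / 1

{-# OPTIONS --safe #-}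

-- Concatenating the two closed walks of a 2-agent exploration gives a closed walk from s through
-- every node, of length at most twice the 2-agent cost (which, in either model, is the length of
-- the longer walk); so on a unicyclic graph the 3-competitive algorithm pays at most 6 ≤ 12 times
-- that cost.  Tadpoles are unicyclic: a tail is a pendant path, no vertex of which lies on a cycle,
-- so every cycle uses only edges of the tadpole's cycle, and since each vertex of a cycle has
-- exactly two neighbours on it, such a cycle is the tadpole's cycle itself.

module Submission where

open import Defs
open import Data.Rational using (_*_)
open import Data.Vec using (Vec)
open import Data.List using (List)

open import Data.Empty using (⊥-elim)
open import Data.Fin using (Fin; zero; suc)
import Data.Integer as ℤ
open import Data.List using ([]; _∷_; _++_; _∷ʳ_; [_]; length; head; last; concat; initLast; _∷ʳ′_)
open import Data.List.Properties using (++-assoc; ++-identityʳ)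
open import Data.List.Membership.Propositional using (_∈_; _∉_)
open import Data.List.Membership.Propositional.Properties using (∈-++⁺ˡ; ∈-++⁺ʳ; ∈-++⁻; ∈-∃++)
open import Data.List.Relation.Binary.Disjoint.Propositional using (Disjoint)
open import Data.List.Relation.Binary.Permutation.Propositional using (↭⇒↭ₛ)
open import Data.List.Relation.Binary.Permutation.Propositional.Properties using (++-comm; ↭-length)
import Data.List.Relation.Binary.Permutation.Setoid.Properties as Permutationₛ
open import Data.List.Relation.Unary.All as All using (All; []; _∷_)
import Data.List.Relation.Unary.All.Properties as All
open import Data.List.Relation.Unary.Any using (here; there)
open import Data.List.Relation.Unary.Linked using (Linked; []; [-]; _∷_)
open import Data.List.Relation.Unary.Unique.Propositional using (Unique; []; _∷_)
open import Data.List.Relation.Unary.Unique.Propositional.Properties using (Unique[x∷xs]⇒x∉xs)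
open import Data.Maybe using (just; nothing)
open import Data.Nat as ℕ using (ℕ; s≤s)
open import Data.Product using (∃; _×_; _,_; proj₁; proj₂)
open import Data.Rational as ℚ using (ℚ; 0ℚ; _+_; _≤_; _⊔_; _/_)
import Data.Rational.Properties as ℚ
open import Data.Rational.Solver using (module +-*-Solver)
open import Data.Sum as Sum using (_⊎_; inj₁; inj₂)
open import Data.Vec using (lookup; toList; []; _∷_)
open import Function using (id; _∘_)
open import Relation.Binary.Construct.Closure.ReflexiveTransitive using (Star; ε; _◅_; _◅◅_; reverse)
open import Relation.Binary.PropositionalEquality using (_≡_; _≢_; refl; sym; trans; cong; subst; setoid)
open import Relation.Nullary.Decidable using (toWitness)

module _ {A : Set} where
  private variable
    a b a′ b′ t u v x y z : A
    l q xs ys c : List A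

  Consec⇒∈ˡ : Consec l u v → u ∈ l
  Consec⇒∈ˡ here      = here refl
  Consec⇒∈ˡ (there e) = there (Consec⇒∈ˡ e)

  Consec⇒∈ʳ : Consec l u v → v ∈ l
  Consec⇒∈ʳ here      = there (here refl)
  Consec⇒∈ʳ (there e) = there (Consec⇒∈ʳ e)

  PathEdge⇒∈ˡ : PathEdge l u v → u ∈ l
  PathEdge⇒∈ˡ = Sum.[ Consec⇒∈ˡ , Consec⇒∈ʳ ]

  PathEdge⇒∈ʳ : PathEdge l u v → v ∈ l
  PathEdge⇒∈ʳ = Sum.[ Consec⇒∈ʳ , Consec⇒∈ˡ ]

  PathEdge-there : PathEdge l u v → PathEdge (x ∷ l) u v
  PathEdge-there = Sum.map there there

  Consec-∷⇒∈ : Consec (x ∷ l) u v → u ∈ l ⊎ v ∈ l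
  Consec-∷⇒∈ here      = inj₂ (here refl)
  Consec-∷⇒∈ (there e) = inj₁ (Consec⇒∈ˡ e)

  PathEdge-∷⇒∈ : PathEdge (x ∷ l) u v → u ∈ l ⊎ v ∈ l
  PathEdge-∷⇒∈ = Sum.[ Consec-∷⇒∈ , Sum.swap ∘ Consec-∷⇒∈ ]

  PathEdge-∷∷⇒ : z ∉ q → PathEdge (y ∷ z ∷ q) z a → a ≡ y ⊎ a ∈ q
  PathEdge-∷∷⇒ z∉q (inj₁ here)              = inj₁ refl
  PathEdge-∷∷⇒ z∉q (inj₁ (there here))      = inj₂ (here refl)
  PathEdge-∷∷⇒ z∉q (inj₁ (there (there e))) = ⊥-elim (z∉q (Consec⇒∈ˡ e))
  PathEdge-∷∷⇒ z∉q (inj₂ here)              = inj₁ refl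
  PathEdge-∷∷⇒ z∉q (inj₂ (there here))      = ⊥-elim (z∉q (here refl))
  PathEdge-∷∷⇒ z∉q (inj₂ (there (there e))) = ⊥-elim (z∉q (Consec⇒∈ʳ e))

  Linked⇒Consec : ∀ {R : A → A → Set} → Linked R l → Consec l u v → R u v
  Linked⇒Consec (r ∷ _)  here      = r
  Linked⇒Consec (_ ∷ rs) (there e) = Linked⇒Consec rs e
  Linked⇒Consec [-]      (there ())

  Consec⇒Linked : ∀ {R : A → A → Set} l → (∀ {u v} → Consec l u v → R u v) → Linked R l
  Consec⇒Linked []          f = []
  Consec⇒Linked (x ∷ [])    f = [-]
  Consec⇒Linked (x ∷ y ∷ l) f = f here ∷ Consec⇒Linked (y ∷ l) (f ∘ there)

  Consec-++⁻ : ∀ xs → Consec (xs ++ y ∷ ys) u v → Consec (xs ∷ʳ y) u v ⊎ Consec (y ∷ ys) u v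
  Consec-++⁻ []            e         = inj₂ e
  Consec-++⁻ (x ∷ [])      here      = inj₁ here
  Consec-++⁻ (x ∷ x′ ∷ xs) here      = inj₁ here
  Consec-++⁻ (x ∷ xs)      (there e) = Sum.map₁ there (Consec-++⁻ xs e)

  Consec-++⁺ : ∀ xs → Consec (xs ∷ʳ y) u v ⊎ Consec (y ∷ ys) u v → Consec (xs ++ y ∷ ys) u v
  Consec-++⁺ []            (inj₁ (there ()))
  Consec-++⁺ []            (inj₂ e)         = e
  Consec-++⁺ (x ∷ [])      (inj₁ here)      = here
  Consec-++⁺ (x ∷ x′ ∷ xs) (inj₁ here)      = here
  Consec-++⁺ (x ∷ xs)      (inj₁ (there e)) = there (Consec-++⁺ xs (inj₁ e))
  Consec-++⁺ (x ∷ xs)      (inj₂ e)         = there (Consec-++⁺ xs (inj₂ e))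

  Consec-∷ʳ⇒∈ : ∀ xs → Consec (xs ∷ʳ y) u v → u ∈ xs
  Consec-∷ʳ⇒∈ []            (there ())
  Consec-∷ʳ⇒∈ (x ∷ [])      here      = here refl
  Consec-∷ʳ⇒∈ (x ∷ x′ ∷ xs) here      = here refl
  Consec-∷ʳ⇒∈ (x ∷ xs)      (there e) = there (Consec-∷ʳ⇒∈ xs e)

  Consec-∷ʳ-∷ʳ : ∀ xs → Consec (xs ∷ʳ y ∷ʳ z) y z
  Consec-∷ʳ-∷ʳ []       = here
  Consec-∷ʳ-∷ʳ (x ∷ xs) = there (Consec-∷ʳ-∷ʳ xs)

  Consec-∷ʳ-∷ʳ⁻ : ∀ xs → y ∉ xs ∷ʳ z → Consec (xs ∷ʳ z ∷ʳ y) v y → v ≡ z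
  Consec-∷ʳ-∷ʳ⁻ []            y∉ here                = refl
  Consec-∷ʳ-∷ʳ⁻ []            y∉ (there (there ()))
  Consec-∷ʳ-∷ʳ⁻ (x ∷ [])      y∉ here                = ⊥-elim (y∉ (there (here refl)))
  Consec-∷ʳ-∷ʳ⁻ (x ∷ x′ ∷ xs) y∉ here                = ⊥-elim (y∉ (there (here refl)))
  Consec-∷ʳ-∷ʳ⁻ (x ∷ xs)      y∉ (there e)           = Consec-∷ʳ-∷ʳ⁻ xs (y∉ ∘ there) e

  last-++ : ∀ p → last p ≡ just y → last (y ∷ q) ≡ just z → last (p ++ q) ≡ just z
  last-++ (x ∷ [])     refl e = e
  last-++ (x ∷ x′ ∷ p) e₁   e₂ = last-++ (x′ ∷ p) e₁ e₂

  ∈-close⁺ : u ∈ c → u ∈ close c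
  ∈-close⁺ {c = x ∷ c} (here refl) = here refl
  ∈-close⁺ {c = x ∷ c} (there u∈c) = there (∈-++⁺ˡ u∈c)

  ∈-close⁻ : ∀ c → u ∈ close c → u ∈ c
  ∈-close⁻ (x ∷ c) (here refl) = here refl
  ∈-close⁻ (x ∷ c) (there u∈) with ∈-++⁻ c u∈
  ... | inj₁ u∈c         = there u∈c
  ... | inj₂ (here refl) = here refl

  CycEdge⇒∈ˡ : ∀ c → CycEdge c u v → u ∈ c
  CycEdge⇒∈ˡ c = ∈-close⁻ c ∘ PathEdge⇒∈ˡ

  CycEdge⇒∈ʳ : ∀ c → CycEdge c u v → v ∈ c
  CycEdge⇒∈ʳ c = ∈-close⁻ c ∘ PathEdge⇒∈ʳ

  Consec-close-rotate : ∀ xs ys → Consec (close (xs ++ ys)) u v → Consec (close (ys ++ xs)) u v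
  Consec-close-rotate []       ys rewrite ++-identityʳ ys = id
  Consec-close-rotate (x ∷ xs) [] rewrite ++-identityʳ xs = id
  Consec-close-rotate (x ∷ xs) (y ∷ ys) e
    rewrite ++-assoc xs (y ∷ ys) [ x ] | ++-assoc ys (x ∷ xs) [ y ] =
      Consec-++⁺ (y ∷ ys) (Sum.swap (Consec-++⁻ (x ∷ xs) e))

  CycEdge-rotate : ∀ xs ys → CycEdge (xs ++ ys) u v → CycEdge (ys ++ xs) u v
  CycEdge-rotate xs ys = Sum.map (Consec-close-rotate xs ys) (Consec-close-rotate xs ys)

  Unique-++⁻ˡ : ∀ xs → Unique (xs ++ ys) → Unique xs
  Unique-++⁻ˡ []       _          = []
  Unique-++⁻ˡ (x ∷ xs) (x∉ ∷ xs!) = All.++⁻ˡ xs x∉ ∷ Unique-++⁻ˡ xs xs!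

  Unique-++⁻ʳ : ∀ xs → Unique (xs ++ ys) → Unique ys
  Unique-++⁻ʳ []       ys!       = ys!
  Unique-++⁻ʳ (x ∷ xs) (_ ∷ xs!) = Unique-++⁻ʳ xs xs!

  Unique-++⇒Disjoint : ∀ xs → Unique (xs ++ ys) → Disjoint xs ys
  Unique-++⇒Disjoint (x ∷ xs) (x∉ ∷ _)   (here refl , v∈ys) = All.lookup (All.++⁻ʳ xs x∉) v∈ys refl
  Unique-++⇒Disjoint (x ∷ xs) (_ ∷ xs!) (there v∈xs , v∈ys) = Unique-++⇒Disjoint xs xs! (v∈xs , v∈ys)

  Unique-rotate : ∀ xs ys → Unique (xs ++ ys) → Unique (ys ++ xs)
  Unique-rotate xs ys = Permutationₛ.Unique-resp-↭ (setoid A) (↭⇒↭ₛ (++-comm xs ys))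

  pair-⊆⇒⊇ : ∀ {P : A → Set} → a′ ≢ b′ → a′ ≡ a ⊎ a′ ≡ b → b′ ≡ a ⊎ b′ ≡ b
           → P a′ → P b′ → v ≡ a ⊎ v ≡ b → P v
  pair-⊆⇒⊇ a′≢b′ (inj₁ refl) (inj₁ refl) _  _  _           = ⊥-elim (a′≢b′ refl)
  pair-⊆⇒⊇ a′≢b′ (inj₂ refl) (inj₂ refl) _  _  _           = ⊥-elim (a′≢b′ refl)
  pair-⊆⇒⊇ a′≢b′ (inj₁ refl) (inj₂ refl) pa pb (inj₁ refl) = pa
  pair-⊆⇒⊇ a′≢b′ (inj₁ refl) (inj₂ refl) pa pb (inj₂ refl) = pb
  pair-⊆⇒⊇ a′≢b′ (inj₂ refl) (inj₁ refl) pa pb (inj₁ refl) = pb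
  pair-⊆⇒⊇ a′≢b′ (inj₂ refl) (inj₁ refl) pa pb (inj₂ refl) = pa

  head⇒∈ : ∀ p → head p ≡ just x → x ∈ p
  head⇒∈ (x ∷ p) refl = here refl

  PathEdge-closed⇒All : ∀ {P : A → Set} l → (∀ {u v} → PathEdge l u v → P u → P v) → y ∈ l → P y → All P l
  PathEdge-closed⇒All (x ∷ [])     f (here refl) py = py ∷ []
  PathEdge-closed⇒All (x ∷ x′ ∷ l) f (here refl) py =
    py ∷ PathEdge-closed⇒All (x′ ∷ l) (f ∘ PathEdge-there) (here refl) (f (inj₁ here) py)
  PathEdge-closed⇒All (x ∷ x′ ∷ l) f (there y∈) py
    with PathEdge-closed⇒All (x′ ∷ l) (f ∘ PathEdge-there) y∈ py
  ... | px′ ∷ pl = f (inj₂ here) px′ ∷ px′ ∷ pl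

  record CycleNeighbours (c : List A) (t : A) : Set where
    field
      left right : A
      left≢right : left ≢ right
      left-edge  : CycEdge c t left
      right-edge : CycEdge c t right
      only       : CycEdge c t v → v ≡ left ⊎ v ≡ right

  CycleNeighbours-rotate : ∀ xs ys → CycleNeighbours (xs ++ ys) t → CycleNeighbours (ys ++ xs) t
  CycleNeighbours-rotate xs ys N = record
    { left       = left
    ; right      = right
    ; left≢right = left≢right
    ; left-edge  = CycEdge-rotate xs ys left-edge
    ; right-edge = CycEdge-rotate xs ys right-edge
    ; only       = only ∘ CycEdge-rotate ys xs
    }
    where open CycleNeighbours N

  cycleNeighbours-head : ∀ t m ys z → Unique (t ∷ m ∷ ys ∷ʳ z) → CycleNeighbours (t ∷ m ∷ ys ∷ʳ z) t
  cycleNeighbours-head t m ys z t∷ms!@(_ ∷ m∉ ∷ _) = record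
    { left       = m
    ; right      = z
    ; left≢right = All.lookup m∉ (∈-++⁺ʳ ys (here refl))
    ; left-edge  = inj₁ here
    ; right-edge = inj₂ (there (Consec-∷ʳ-∷ʳ (m ∷ ys)))
    ; only       = only
    }
    where
      t∉ : t ∉ m ∷ ys ∷ʳ z
      t∉ = Unique[x∷xs]⇒x∉xs t∷ms!

      only : ∀ {v} → CycEdge (t ∷ m ∷ ys ∷ʳ z) t v → v ≡ m ⊎ v ≡ z
      only (inj₁ here)      = inj₁ refl
      only (inj₁ (there e)) = ⊥-elim (t∉ (Consec-∷ʳ⇒∈ (m ∷ ys ∷ʳ z) e))
      only (inj₂ here)      = ⊥-elim (t∉ (here refl))
      only (inj₂ (there e)) = inj₂ (Consec-∷ʳ-∷ʳ⁻ (m ∷ ys) t∉ e)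

  cycleNeighbours : Unique c → 3 ℕ.≤ length c → t ∈ c → CycleNeighbours c t
  cycleNeighbours {t = t} c! len t∈c with ∈-∃++ t∈c
  ... | pre , post , refl = CycleNeighbours-rotate (t ∷ post) pre (atHead (post ++ pre) c!′ len′)
    where
      c!′ : Unique (t ∷ post ++ pre)
      c!′ = Unique-rotate pre (t ∷ post) c!

      len′ : 3 ℕ.≤ length (t ∷ post ++ pre)
      len′ = subst (3 ℕ.≤_) (↭-length (++-comm pre (t ∷ post))) len

      atHead : ∀ q → Unique (t ∷ q) → 3 ℕ.≤ length (t ∷ q) → CycleNeighbours (t ∷ q) t
      atHead []       _  (s≤s ())
      atHead (m ∷ ms) q! len with initLast ms
      atHead (m ∷ ms) q! (s≤s (s≤s ())) | []
      ... | ys ∷ʳ′ z = cycleNeighbours-head t m ys z q!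

  module _ {c c′ : List A} (c! : Unique c) (len : 3 ℕ.≤ length c)
           (c′! : Unique c′) (len′ : 3 ℕ.≤ length c′)
           (c′⊆c : ∀ {u v} → CycEdge c′ u v → CycEdge c u v) where

    private
      c′⊆c-vertices : u ∈ c′ → u ∈ c
      c′⊆c-vertices u∈c′ = CycEdge⇒∈ˡ c (c′⊆c (CycleNeighbours.left-edge (cycleNeighbours c′! len′ u∈c′)))

      CycEdge-at : u ∈ c′ → CycEdge c u v → CycEdge c′ u v
      CycEdge-at u∈c′ e =
        pair-⊆⇒⊇ N′.left≢right (N.only (c′⊆c N′.left-edge)) (N.only (c′⊆c N′.right-edge))
                 N′.left-edge N′.right-edge (N.only e)
        where
          module N′ = CycleNeighbours (cycleNeighbours c′! len′ u∈c′)
          module N  = CycleNeighbours (cycleNeighbours c! len (c′⊆c-vertices u∈c′))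

      someVertex : ∀ (l : List A) → 3 ℕ.≤ length l → ∃ (_∈ l)
      someVertex []      ()
      someVertex (x ∷ _) _  = x , here refl

      close-c⊆c′ : All (_∈ c′) (close c)
      close-c⊆c′ with someVertex c′ len′
      ... | y , y∈c′ = PathEdge-closed⇒All (close c) (λ e u∈c′ → CycEdge⇒∈ʳ c′ (CycEdge-at u∈c′ e))
                         (∈-close⁺ (c′⊆c-vertices y∈c′)) y∈c′

    CycEdge-⊆⇒same : ∀ u v → (CycEdge c u v → CycEdge c′ u v) × (CycEdge c′ u v → CycEdge c u v)
    CycEdge-⊆⇒same u v = (λ e → CycEdge-at (All.lookup close-c⊆c′ (PathEdge⇒∈ˡ e)) e) , c′⊆c

Pendant : {A : Set} → (A → A → Set) → A → List A → Set
Pendant E y p = ∀ {t a} → t ∈ p → E t a → PathEdge (y ∷ p) t a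

module _ {A : Set} {E : A → A → Set} where
  private variable
    y z : A
    q : List A

  Pendant-∷ : Unique (y ∷ z ∷ q) → Pendant E y (z ∷ q) → Pendant E z q
  Pendant-∷ (y∉ ∷ z∉ ∷ _) H t∈q e with H (there t∈q) e
  ... | inj₁ here       = ⊥-elim (All.lookup y∉ (there t∈q) refl)
  ... | inj₁ (there e′) = inj₁ e′
  ... | inj₂ here       = ⊥-elim (All.lookup z∉ t∈q refl)
  ... | inj₂ (there e′) = inj₂ e′

  -- Induct from the far end: once the later vertices avoid c, the only neighbour that
  -- a vertex of the path could have on c is its predecessor, but cycle vertices have two.
  Pendant⇒∉cycle : ∀ {c} → Unique c → 3 ℕ.≤ length c → (∀ {u v} → CycEdge c u v → E u v)
                 → ∀ {y p t} → Unique (y ∷ p) → Pendant E y p → t ∈ p → t ∉ c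
  Pendant⇒∉cycle c! len c⊆E {p = z ∷ q} yzq!@(_ ∷ zq!) H (there t∈q) =
    Pendant⇒∉cycle c! len c⊆E zq! (Pendant-∷ yzq! H) t∈q
  Pendant⇒∉cycle {c} c! len c⊆E {y} {z ∷ q} yzq!@(_ ∷ zq!) H (here refl) z∈c =
    left≢right (trans (toPredecessor left-edge) (sym (toPredecessor right-edge)))
    where
      open CycleNeighbours (cycleNeighbours c! len z∈c)
      toPredecessor : ∀ {a} → CycEdge c z a → a ≡ y
      toPredecessor e with PathEdge-∷∷⇒ (Unique[x∷xs]⇒x∉xs zq!) (H (here refl) (c⊆E e))
      ... | inj₁ a≡y = a≡y
      ... | inj₂ a∈q = ⊥-elim (Pendant⇒∉cycle c! len c⊆E zq! (Pendant-∷ yzq! H) a∈q (CycEdge⇒∈ʳ c e))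

module _ {A : Set} where
  private variable
    x : A

  ∈-lookup⇒∈-concat : ∀ {n} (xss : Vec (List A) n) i → x ∈ lookup xss i → x ∈ concat (toList xss)
  ∈-lookup⇒∈-concat (xs ∷ xss) zero    x∈ = ∈-++⁺ˡ x∈
  ∈-lookup⇒∈-concat (xs ∷ xss) (suc i) x∈ = ∈-++⁺ʳ xs (∈-lookup⇒∈-concat xss i x∈)

  ∈-concat⇒∈-lookup : ∀ {n} (xss : Vec (List A) n) → x ∈ concat (toList xss) → ∃ λ i → x ∈ lookup xss i
  ∈-concat⇒∈-lookup (xs ∷ xss) x∈ with ∈-++⁻ xs x∈
  ... | inj₁ x∈xs  = zero , x∈xs
  ... | inj₂ x∈xss with ∈-concat⇒∈-lookup xss x∈xss
  ...   | i , x∈i = suc i , x∈i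

  Unique-concat⇒Unique-lookup : ∀ {n} (xss : Vec (List A) n) i
                              → Unique (concat (toList xss)) → Unique (lookup xss i)
  Unique-concat⇒Unique-lookup (xs ∷ xss) zero    xss! = Unique-++⁻ˡ xs xss!
  Unique-concat⇒Unique-lookup (xs ∷ xss) (suc i) xss! =
    Unique-concat⇒Unique-lookup xss i (Unique-++⁻ʳ xs xss!)

  Unique-concat⇒index-unique : ∀ {n} (xss : Vec (List A) n) {i k} → Unique (concat (toList xss))
                             → x ∈ lookup xss i → x ∈ lookup xss k → i ≡ k
  Unique-concat⇒index-unique (xs ∷ xss) {zero}  {zero}  _    _   _   = refl
  Unique-concat⇒index-unique (xs ∷ xss) {zero}  {suc k} xss! x∈i x∈k =
    ⊥-elim (Unique-++⇒Disjoint xs xss! (x∈i , ∈-lookup⇒∈-concat xss k x∈k))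
  Unique-concat⇒index-unique (xs ∷ xss) {suc i} {zero}  xss! x∈i x∈k =
    ⊥-elim (Unique-++⇒Disjoint xs xss! (x∈k , ∈-lookup⇒∈-concat xss i x∈i))
  Unique-concat⇒index-unique (xs ∷ xss) {suc i} {suc k} xss! x∈i x∈k =
    cong suc (Unique-concat⇒index-unique xss (Unique-++⁻ʳ xs xss!) x∈i x∈k)

module _ {A : Set} {R : A → A → Set} where

  Linked⇒Star : ∀ {x y l} → Linked R (x ∷ l) → y ∈ x ∷ l → Star R x y
  Linked⇒Star _        (here refl) = ε
  Linked⇒Star (r ∷ rs) (there y∈)  = r ◅ Linked⇒Star rs y∈
  Linked⇒Star [-]      (there ())

  Star⇒Linked : ∀ {x y} → Star R x y → ∃ λ l → Linked R (x ∷ l) × last (x ∷ l) ≡ just y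
  Star⇒Linked ε        = [] , [-] , refl
  Star⇒Linked (r ◅ rs) with Star⇒Linked rs
  ... | l , rs′ , last≡ = _ ∷ l , r ∷ rs′ , last≡

module _ (G : Graph) where
  open Graph G using (w; w-sym; w-pos)

  private variable
    u v x : V G
    q : List (V G)

  Adj-sym : Adj G u v → Adj G v u
  Adj-sym {u} {v} (l , w≡) = l , trans (w-sym v u) w≡

  CycEdge⇒Adj : ∀ {c} → Linked (Adj G) (close c) → CycEdge c u v → Adj G u v
  CycEdge⇒Adj walk = Sum.[ Linked⇒Consec walk , Adj-sym ∘ Linked⇒Consec walk ]

  reachable⇒Connected : ∀ x → (∀ v → Star (Adj G) x v) → Connected G
  reachable⇒Connected x reach u v with Star⇒Linked (reverse Adj-sym (reach u) ◅◅ reach v)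
  ... | l , walk , last≡ = u ∷ l , walk , refl , last≡

  Joins : List (V G) → V G → V G → Set
  Joins p u v = IsWalk G p × head p ≡ just u × last p ≡ just v

  IsWalk-++ : ∀ p → IsWalk G p → last p ≡ just v → IsWalk G (v ∷ q) → IsWalk G (p ++ q)
  IsWalk-++ (x ∷ [])     _          refl walk₂ = walk₂
  IsWalk-++ (x ∷ x′ ∷ p) (r ∷ walk₁) last≡ walk₂ = r ∷ IsWalk-++ (x′ ∷ p) walk₁ last≡ walk₂

  Joins-++ : ∀ p → Joins p u v → Joins (v ∷ q) v x → Joins (p ++ q) u x
  Joins-++ (y ∷ p) (walk₁ , refl , last₁) (walk₂ , _ , last₂) =
    IsWalk-++ (y ∷ p) walk₁ last₁ walk₂ , refl , last-++ (y ∷ p) last₁ last₂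

  wt-nonneg : ∀ u v → 0ℚ ≤ wt G u v
  wt-nonneg u v with w u v in w≡
  ... | just l  = ℚ.<⇒≤ (w-pos u v l w≡)
  ... | nothing = ℚ.≤-refl

  walkLen-nonneg : ∀ p → 0ℚ ≤ walkLen G p
  walkLen-nonneg []          = ℚ.≤-refl
  walkLen-nonneg (x ∷ [])    = ℚ.≤-refl
  walkLen-nonneg (x ∷ y ∷ p) = ℚ.+-mono-≤ (wt-nonneg x y) (walkLen-nonneg (y ∷ p))

  walkLen-++ : ∀ p → last p ≡ just v → walkLen G (p ++ q) ≡ walkLen G p + walkLen G (v ∷ q)
  walkLen-++ (x ∷ [])     refl  = sym (ℚ.+-identityˡ _)
  walkLen-++ (x ∷ x′ ∷ p) last≡ =
    trans (cong (wt G x x′ +_) (walkLen-++ (x′ ∷ p) last≡))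
          (sym (ℚ.+-assoc (wt G x x′) (walkLen G (x′ ∷ p)) _))

  OfflineExpl-merge : ∀ s w₁ w₂ → OfflineExpl G s 2 (w₁ ∷ w₂ ∷ [])
                    → ∃ λ W → OfflineExpl G s 1 (W ∷ []) × walkLen G W ≡ walkLen G w₁ + walkLen G w₂
  OfflineExpl-merge s w₁ [] (walks , _) with walks (suc zero)
  ... | _ , () , _
  OfflineExpl-merge s w₁ (x ∷ r) (walks , covers) with walks zero | walks (suc zero)
  ... | j₁@(_ , head₁ , last₁) | j₂@(_ , refl , _) =
    w₁ ++ r , ((λ { zero → Joins-++ w₁ j₁ j₂ }) , λ v → zero , covered v) , walkLen-++ w₁ last₁
    where
      covered : ∀ v → v ∈ w₁ ++ r
      covered v with covers v
      ... | zero     , v∈w₁      = ∈-++⁺ˡ v∈w₁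
      ... | suc zero , here refl = ∈-++⁺ˡ (head⇒∈ w₁ head₁)
      ... | suc zero , there v∈r = ∈-++⁺ʳ w₁ v∈r

three-sum≤twelve-max : ∀ {a b} → 0ℚ ≤ a → 0ℚ ≤ b → three * ((a + b) ⊔ 0ℚ) ≤ twelve * (a ⊔ (b ⊔ 0ℚ))
three-sum≤twelve-max {a} {b} 0≤a 0≤b = begin
  three * ((a + b) ⊔ 0ℚ) ≤⟨ ℚ.*-monoˡ-≤-nonNeg three (ℚ.⊔-lub (ℚ.+-mono-≤ a≤M b≤M) (ℚ.+-mono-≤ 0≤M 0≤M)) ⟩
  three * (M + M)        ≡⟨ double M ⟩
  six * M                ≤⟨ ℚ.*-monoʳ-≤-nonNeg M {{ℚ.nonNegative 0≤M}} 6≤12 ⟩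
  twelve * M             ∎
  where
    open ℚ.≤-Reasoning
    M : ℚ
    M = a ⊔ (b ⊔ 0ℚ)

    six : ℚ
    six = ℤ.+ 6 / 1

    a≤M : a ≤ M
    a≤M = ℚ.p≤p⊔q a (b ⊔ 0ℚ)
    b≤M : b ≤ M
    b≤M = ℚ.≤-trans (ℚ.p≤p⊔q b 0ℚ) (ℚ.p≤q⊔p a (b ⊔ 0ℚ))
    0≤M : 0ℚ ≤ M
    0≤M = ℚ.≤-trans 0≤a a≤M

    double : ∀ x → three * (x + x) ≡ six * x
    double = solve 1 (λ x → con three :* (x :+ x) := con six :* x) refl
      where open +-*-Solver

    6≤12 : six ≤ twelve
    6≤12 = toWitness {a? = six ℚ.≤? twelve} _

ExploresWithin-mono : ∀ {G s A} m {B B′} → B ≤ B′ → ExploresWithin G s A m B → ExploresWithin G s A m B′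
ExploresWithin-mono _ B≤B′ (k , c , run≡ , finished , cost≤B) =
  k , c , run≡ , finished , ℚ.≤-trans cost≤B B≤B′

module Tadpole (G : Graph) {n : ℕ} (x₀ : V G) (r : List (V G)) (cycle : IsCycle G (x₀ ∷ r))
  (tails : Vec (List (V G)) n) (att : Vec (V G) n)
  (att∈c : ∀ i → lookup att i ∈ x₀ ∷ r)
  (unique : Unique ((x₀ ∷ r) ++ concat (toList tails)))
  (covers : ∀ v → v ∈ (x₀ ∷ r) ++ concat (toList tails))
  (edges : ∀ u v → (Adj G u v → CycEdge (x₀ ∷ r) u v ⊎ ∃ λ i → PathEdge (lookup att i ∷ lookup tails i) u v)
                 × (CycEdge (x₀ ∷ r) u v ⊎ (∃ λ i → PathEdge (lookup att i ∷ lookup tails i) u v) → Adj G u v))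
  where

  c : List (V G)
  c = x₀ ∷ r

  T : List (V G)
  T = concat (toList tails)

  Tail : Fin n → List (V G)
  Tail i = lookup att i ∷ lookup tails i

  c-length : 3 ℕ.≤ length c
  c-length = proj₁ cycle

  c-unique : Unique c
  c-unique = proj₁ (proj₂ cycle)

  c-walk : IsWalk G (close c)
  c-walk = proj₂ (proj₂ cycle)

  c#T : Disjoint c T
  c#T = Unique-++⇒Disjoint c unique

  T-unique : Unique T
  T-unique = Unique-++⁻ʳ c unique

  Tail-unique : ∀ i → Unique (Tail i)
  Tail-unique i =
    All.tabulate (λ v∈ att≡v → c#T (subst (_∈ c) att≡v (att∈c i) , ∈-lookup⇒∈-concat tails i v∈))
    ∷ Unique-concat⇒Unique-lookup tails i T-unique

  Tail-walk : ∀ i → IsWalk G (Tail i)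
  Tail-walk i = Consec⇒Linked (Tail i) (λ e → proj₂ (edges _ _) (inj₂ (i , inj₁ e)))

  Tail-pendant : ∀ i → Pendant (Adj G) (lookup att i) (lookup tails i)
  Tail-pendant i {t} {a} t∈i t~a with proj₁ (edges t a) t~a
  ... | inj₁ e = ⊥-elim (c#T (CycEdge⇒∈ˡ c e , ∈-lookup⇒∈-concat tails i t∈i))
  ... | inj₂ (k , e) with PathEdge⇒∈ˡ e
  ...   | here refl = ⊥-elim (c#T (att∈c k , ∈-lookup⇒∈-concat tails i t∈i))
  ...   | there t∈k with Unique-concat⇒index-unique tails T-unique t∈i t∈k
  ...     | refl = e

  reach : ∀ v → Star (Adj G) x₀ v
  reach v with ∈-++⁻ c (covers v)
  ... | inj₁ v∈c = Linked⇒Star c-walk (∈-close⁺ v∈c)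
  ... | inj₂ v∈T with ∈-concat⇒∈-lookup tails v∈T
  ...   | i , v∈i = Linked⇒Star c-walk (∈-close⁺ (att∈c i)) ◅◅ Linked⇒Star (Tail-walk i) (there v∈i)

  cycle#T : ∀ {c′} → IsCycle G c′ → Disjoint c′ T
  cycle#T (len′ , c′! , c′-walk) (u∈c′ , u∈T) with ∈-concat⇒∈-lookup tails u∈T
  ... | i , u∈i =
    Pendant⇒∉cycle c′! len′ (CycEdge⇒Adj G c′-walk) (Tail-unique i) (Tail-pendant i) u∈i u∈c′

  cycle⊆c : ∀ {c′ u v} → IsCycle G c′ → CycEdge c′ u v → CycEdge c u v
  cycle⊆c {c′} {u} {v} cyc′@(_ , _ , c′-walk) e with proj₁ (edges u v) (CycEdge⇒Adj G c′-walk e)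
  ... | inj₁ e₀ = e₀
  ... | inj₂ (k , eₖ) with PathEdge-∷⇒∈ eₖ
  ...   | inj₁ u∈k = ⊥-elim (cycle#T cyc′ (CycEdge⇒∈ˡ c′ e , ∈-lookup⇒∈-concat tails k u∈k))
  ...   | inj₂ v∈k = ⊥-elim (cycle#T cyc′ (CycEdge⇒∈ʳ c′ e , ∈-lookup⇒∈-concat tails k v∈k))

  unicyclic : Unicyclic G
  unicyclic =
    reachable⇒Connected G x₀ reach , c , cycle ,
    λ { c′ cyc′@(len′ , c′! , _) → CycEdge-⊆⇒same c-unique c-length c′! len′ (cycle⊆c cyc′) }

tadpole⇒unicyclic : ∀ G n → IsTadpole G n → Unicyclic G
tadpole⇒unicyclic G n ([] , (() , _) , _)
tadpole⇒unicyclic G n (x₀ ∷ r , cycle , tails , att , att∈c , _ , unique , covers , edges) =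
  Tadpole.unicyclic G x₀ r cycle tails att att∈c unique covers edges

theorem11 : (m : Model) (A : Algorithm)
    → (∀ (G : Graph) (s : V G) → Unicyclic G
         → ∀ (ws : Vec (List (V G)) 1) → OfflineExpl G s 1 ws
         → ExploresWithin G s A m (three * offCost G m ws))
    → ∀ (n : ℕ) (G : Graph) (s : V G) → IsTadpole G n
    → ∀ (ws : Vec (List (V G)) 2) → OfflineExpl G s 2 ws
    → ExploresWithin G s A m (twelve * offCost G m ws)
theorem11 m A explore n G s tadpole (w₁ ∷ w₂ ∷ []) expl
  with W , explW , len-W ← OfflineExpl-merge G s w₁ w₂ expl =
  ExploresWithin-mono m cost≤
    (explore G s (tadpole⇒unicyclic G n tadpole) (W ∷ []) explW)
  where
    cost≤ : three * (walkLen G W ⊔ 0ℚ) ≤ twelve * (walkLen G w₁ ⊔ (walkLen G w₂ ⊔ 0ℚ))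
    cost≤ = subst (λ ℓ → three * (ℓ ⊔ 0ℚ) ≤ _) (sym len-W)
                  (three-sum≤twelve-max (walkLen-nonneg G w₁) (walkLen-nonneg G w₂))
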